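{- Let $G$ be a finite simple graph of order $p$ without isolated vertices. For $1\le i\le p-1$ let $x_i=\min\{|N_G(S)\setminus S| : S\subseteq V(G),\ |S|=i\}$, and let $\xi=\max\{x_i-i+1 : 1\le i\le p-1\}$. Then $str(G)\ge p+\xi$.
   Context: For $S\subseteq V(G)$, $N_G(S)$ is the set of all vertices adjacent to at least one vertex of $S$. For a graph $G$ of order $p$ with at least one edge, a numbering is a bijection $f:V(G)\to\{1,\dots,p\}$; $str_f(G)=\max\{f(u)+f(v): uv\in E(G)\}$ and $str(G)=\min\{str_f(G): f \text{ a numbering of } G\}$. -}

module Defs where

open import Data.Bool using (Bool; true; false; _∧_; not; if_then_else_)
open import Data.Nat using (ℕ; zero; suc; _+_; _⊔_; _⊓_; _≡ᵇ_)
open import Data.Fin using (Fin; toℕ)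
open import Data.Fin.Subset using (Subset; ∣_∣)
open import Data.Fin.Permutation using (Permutation′; _⟨$⟩ʳ_)
open import Data.List using (List; []; _∷_; _++_; map; foldr; filter; allFin; concatMap)
open import Data.Bool.ListAction using (any)
open import Data.Vec using (Vec; []; _∷_; tabulate; lookup)
open import Data.Product using (Σ; _×_; ∃; ∃-syntax)
open import Data.Integer as ℤ using (ℤ; +_)
open import Relation.Binary.PropositionalEquality using (_≡_)

record SimpleGraph (p : ℕ) : Set where
  field
    adj     : Fin p → Fin p → Bool
    sym     : ∀ u v → adj u v ≡ adj v u
    irrefl  : ∀ v → adj v v ≡ false
open SimpleGraph public

NoIsolated : ∀ {p} → SimpleGraph p → Set
NoIsolated {p} G = ∀ (v : Fin p) → ∃[ u ] (adj G v u ≡ true)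

nbhdMinus : ∀ {p} → SimpleGraph p → Subset p → Subset p
nbhdMinus {p} G S =
  tabulate λ v → not (lookup S v) ∧ any (λ u → lookup S u ∧ adj G u v) (allFin p)

allSubsets : ∀ n → List (Subset n)
allSubsets zero = [] ∷ []
allSubsets (suc n) = map (true ∷_) (allSubsets n) ++ map (false ∷_) (allSubsets n)

-- x_i = min { |N(S) \ S| : |S| = i }.  The fold starts at p, which is an
-- upper bound of every |N(S)\S|, so for 1 ≤ i ≤ p-1 (where subsets of size
-- i exist) this is exactly the minimum.
xSeq : ∀ {p} → SimpleGraph p → ℕ → ℕ
xSeq {p} G i =
  foldr (λ S m → if ∣ S ∣ ≡ᵇ i then ∣ nbhdMinus G S ∣ ⊓ m else m) p (allSubsets p)

xiTerm : ∀ {p} → SimpleGraph p → ℕ → ℤ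
xiTerm G i = (+ xSeq G i) ℤ.- (+ i) ℤ.+ (+ 1)

-- ξ = max { x_i - i + 1 : 1 ≤ i ≤ p-1 }.  (The seed xiTerm 1 is itself one
-- of the terms whenever p ≥ 2, which holds for graphs with no isolated vertex.)
xi : ∀ {p} → SimpleGraph p → ℤ
xi {p} G = foldr ℤ._⊔_ (xiTerm G 1)
  (map (λ k → xiTerm G (suc (toℕ k))) (allFin (p Data.Nat.∸ 1)))

-- A numbering is a bijection V(G) → {1,…,p}; we use a permutation σ of
-- Fin p with f(v) = toℕ (σ v) + 1.
Numbering : ℕ → Set
Numbering p = Permutation′ p

label : ∀ {p} → Numbering p → Fin p → ℕ
label f v = suc (toℕ (f ⟨$⟩ʳ v))

strF : ∀ {p} → SimpleGraph p → Numbering p → ℕ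
strF {p} G f =
  foldr _⊔_ 0
    (concatMap (λ u → map (λ v → if adj G u v then label f u + label f v else 0)
                          (allFin p))
               (allFin p))

IsStr : ∀ {p} → SimpleGraph p → ℕ → Set
IsStr {p} G s = (∃[ f ] (strF G f ≡ s)) × (∀ (f : Numbering p) → s Data.Nat.≤ strF G f)

{-# OPTIONS --safe #-}
-- Fix a numbering f and 1 ≤ i ≤ p, and let S be the set of the i vertices with the
-- largest labels p-i+1, …, p.  The t = |N(S) \ S| ≥ x_i vertices of N(S) \ S carry
-- distinct labels, so one of them, v, has label at least t; it is adjacent to some
-- u ∈ S, whose label is at least p-i+1.  Hence str_f(G) ≥ f(u) + f(v) ≥ p - i + 1 + x_i.
-- When t = 0 any edge at a vertex of S will do, and one exists as G has no isolated
-- vertex.  Maximising over i and minimising over f gives str(G) ≥ p + ξ.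
module Submission where

open import Defs hiding (sym)
open import Data.Nat using (ℕ)
open import Data.Integer using (+_; _+_; _≤_)

open import Data.Bool using (Bool; true; false; _∧_; not; if_then_else_; T)
open import Data.Bool.Properties using (T-≡; T-∧)
open import Data.Bool.ListAction using (any)
open import Data.Nat as ℕ using (zero; suc; _∸_; _⊔_; _⊓_; _≡ᵇ_; _<ᵇ_; z≤n; s≤s)
import Data.Nat.Properties as ℕP
open import Data.Fin as Fin using (Fin; toℕ)
import Data.Fin.Properties as FinP
open import Data.Fin.Subset using (Subset; ∣_∣)
open import Data.Fin.Permutation as Perm using (Permutation′; _⟨$⟩ʳ_; _⟨$⟩ˡ_)
open import Data.List using (List; []; _∷_; map; foldr; allFin)
open import Data.List.Membership.Propositional using (_∈_)
open import Data.List.Membership.Propositional.Properties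
  using (∈-map⁺; ∈-++⁺ˡ; ∈-++⁺ʳ; ∈-allFin; ∈-concatMap⁺)
open import Data.List.Relation.Unary.Any as Any using (here; there)
open import Data.List.Relation.Unary.Any.Properties using (any⁻)
open import Data.Vec using ([]; _∷_; tabulate; lookup)
open import Data.Vec.Properties using (lookup∘tabulate; tabulate∘lookup)
open import Data.Product using (∃-syntax; _×_; _,_; proj₂)
import Data.Integer as ℤ
import Data.Integer.Properties as ℤP
open import Data.Integer.Tactic.RingSolver using (solve-∀)
open import Function using (_∘_; Equivalence)
open import Relation.Binary.PropositionalEquality
  using (_≡_; refl; sym; trans; cong; subst; subst₂; module ≡-Reasoning)
import Algebra.Properties.CommutativeMonoid.Sum ℕP.+-0-commutativeMonoid as Σ
open import Algebra.Properties.CommutativeSemigroup ℕP.+-commutativeSemigroup using (xy∙z≈xz∙y)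

private
  variable
    n p i : ℕ

∣tabulate∣≡sum : (h : Fin n → Bool) → ∣ tabulate h ∣ ≡ Σ.sum (λ k → if h k then 1 else 0)
∣tabulate∣≡sum {zero} h = refl
∣tabulate∣≡sum {suc n} h with h Fin.zero
... | true  = cong suc (∣tabulate∣≡sum (h ∘ Fin.suc))
... | false = ∣tabulate∣≡sum (h ∘ Fin.suc)

∣tabulate∘permute∣ : (σ : Permutation′ n) (h : Fin n → Bool) →
                     ∣ tabulate (h ∘ (σ ⟨$⟩ʳ_)) ∣ ≡ ∣ tabulate h ∣
∣tabulate∘permute∣ σ h = begin
  ∣ tabulate (h ∘ (σ ⟨$⟩ʳ_)) ∣                  ≡⟨ ∣tabulate∣≡sum (h ∘ (σ ⟨$⟩ʳ_)) ⟩
  Σ.sum (λ k → if h (σ ⟨$⟩ʳ k) then 1 else 0)  ≡⟨ Σ.sum-permute (λ k → if h k then 1 else 0) σ ⟨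
  Σ.sum (λ k → if h k then 1 else 0)           ≡⟨ ∣tabulate∣≡sum h ⟨
  ∣ tabulate h ∣                               ∎
  where open ≡-Reasoning

∣tabulate-<ᵇ∣ : ∀ n m → ∣ tabulate {n = n} (λ k → m <ᵇ suc (toℕ k)) ∣ ≡ n ∸ m
∣tabulate-<ᵇ∣ zero    zero    = refl
∣tabulate-<ᵇ∣ zero    (suc m) = refl
∣tabulate-<ᵇ∣ (suc n) zero    = cong suc (∣tabulate-<ᵇ∣ n zero)
∣tabulate-<ᵇ∣ (suc n) (suc m) = ∣tabulate-<ᵇ∣ n m

∃-member-∣X∣≤1+index : (X : Subset n) → 0 ℕ.< ∣ X ∣ →
                        ∃[ k ] (lookup X k ≡ true × ∣ X ∣ ℕ.≤ suc (toℕ k))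
∃-member-∣X∣≤1+index (true ∷ X) _ with ∣ X ∣ in ∣X∣≡
... | zero  = Fin.zero , refl , ℕP.≤-refl
... | suc _ with ∃-member-∣X∣≤1+index X (subst (0 ℕ.<_) (sym ∣X∣≡) (s≤s z≤n))
...   | k , k∈X , bound = Fin.suc k , k∈X , s≤s (subst (ℕ._≤ suc (toℕ k)) ∣X∣≡ bound)
∃-member-∣X∣≤1+index (false ∷ X) 0<∣X∣ with ∃-member-∣X∣≤1+index X 0<∣X∣
... | k , k∈X , bound = Fin.suc k , k∈X , ℕP.m≤n⇒m≤1+n bound

∃-member-∣X∣≤label : (f : Numbering p) (X : Subset p) → 0 ℕ.< ∣ X ∣ →
                      ∃[ v ] (lookup X v ≡ true × ∣ X ∣ ℕ.≤ label f v)
∃-member-∣X∣≤label f X 0<∣X∣ =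
  let k , k∈X′ , bound = ∃-member-∣X∣≤1+index X′ (subst (0 ℕ.<_) (sym ∣X′∣≡∣X∣) 0<∣X∣)
  in  f ⟨$⟩ˡ k , trans (sym (lookup∘tabulate _ k)) k∈X′ ,
      subst₂ ℕ._≤_ ∣X′∣≡∣X∣ (cong (suc ∘ toℕ) (sym (Perm.inverseʳ f))) bound
  where
  X′ : Subset _
  X′ = tabulate (lookup X ∘ (f ⟨$⟩ˡ_))
  ∣X′∣≡∣X∣ : ∣ X′ ∣ ≡ ∣ X ∣
  ∣X′∣≡∣X∣ = trans (∣tabulate∘permute∣ (Perm.flip f) (lookup X)) (cong ∣_∣ (tabulate∘lookup X))

topLabels : Numbering p → ℕ → Subset p
topLabels {p} f i = tabulate (λ v → p ∸ i <ᵇ label f v)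

∣topLabels∣ : (f : Numbering p) → i ℕ.≤ p → ∣ topLabels f i ∣ ≡ i
∣topLabels∣ {p} {i} f i≤p = begin
  ∣ topLabels f i ∣         ≡⟨ ∣tabulate∘permute∣ f labelAbove ⟩
  ∣ tabulate labelAbove ∣   ≡⟨ ∣tabulate-<ᵇ∣ p (p ∸ i) ⟩
  p ∸ (p ∸ i)               ≡⟨ ℕP.m∸[m∸n]≡n i≤p ⟩
  i                         ∎
  where
  open ≡-Reasoning
  labelAbove : Fin p → Bool
  labelAbove k = p ∸ i <ᵇ suc (toℕ k)

topLabels⇒p∸i<label : (f : Numbering p) (i : ℕ) {v : Fin p} → lookup (topLabels f i) v ≡ true →
                   p ∸ i ℕ.< label f v
topLabels⇒p∸i<label {p} f i {v} v∈ =
  ℕP.<ᵇ⇒< (p ∸ i) (label f v) (Equivalence.from T-≡ (trans (sym (lookup∘tabulate _ v)) v∈))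

nbhdMinus-witness : (G : SimpleGraph p) (S : Subset p) {v : Fin p} →
                    lookup (nbhdMinus G S) v ≡ true →
                    ∃[ u ] (lookup S u ≡ true × adj G u v ≡ true)
nbhdMinus-witness {p} G S {v} v∈ =
  let u , u∈S∧uv = Any.satisfied (any⁻ _ (allFin p) (proj₂ (Equivalence.to T-∧ v∈′)))
      u∈S , uv   = Equivalence.to T-∧ u∈S∧uv
  in  u , Equivalence.to T-≡ u∈S , Equivalence.to T-≡ uv
  where
  v∈′ : T (not (lookup S v) ∧ any (λ u → lookup S u ∧ adj G u v) (allFin p))
  v∈′ = Equivalence.from T-≡ (trans (sym (lookup∘tabulate _ v)) v∈)

allSubsets-complete : (X : Subset n) → X ∈ allSubsets n
allSubsets-complete []                = here refl
allSubsets-complete {suc n} (true ∷ X)  = ∈-++⁺ˡ (∈-map⁺ (true ∷_) (allSubsets-complete X))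
allSubsets-complete {suc n} (false ∷ X) =
  ∈-++⁺ʳ (map (true ∷_) (allSubsets n)) (∈-map⁺ (false ∷_) (allSubsets-complete X))

module _ {A : Set} (b : A → Bool) (g : A → ℕ) (e : ℕ) where

  guardedMin : List A → ℕ
  guardedMin = foldr (λ y m → if b y then g y ⊓ m else m) e

  guardedMin-≤ : {x : A} {xs : List A} → x ∈ xs → b x ≡ true → guardedMin xs ℕ.≤ g x
  guardedMin-≤ {x} {_ ∷ xs} (here refl) bx rewrite bx = ℕP.m⊓n≤m (g x) (guardedMin xs)
  guardedMin-≤ {_} {y ∷ xs} (there x∈xs) bx = ℕP.≤-trans step (guardedMin-≤ x∈xs bx)
    where
    step : (if b y then g y ⊓ guardedMin xs else guardedMin xs) ℕ.≤ guardedMin xs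
    step with b y
    ... | true  = ℕP.m⊓n≤n (g y) (guardedMin xs)
    ... | false = ℕP.≤-refl

xSeq≤∣nbhdMinus∣ : (G : SimpleGraph p) (S : Subset p) → ∣ S ∣ ≡ i → xSeq G i ℕ.≤ ∣ nbhdMinus G S ∣
xSeq≤∣nbhdMinus∣ {p} {i} G S ∣S∣≡i =
  guardedMin-≤ (λ X → ∣ X ∣ ≡ᵇ i) (λ X → ∣ nbhdMinus G X ∣) p (allSubsets-complete S)
               (Equivalence.to T-≡ (ℕP.≡⇒≡ᵇ ∣ S ∣ i ∣S∣≡i))

∈⇒≤foldr-⊔ : {x e : ℕ} {xs : List ℕ} → x ∈ xs → x ℕ.≤ foldr _⊔_ e xs
∈⇒≤foldr-⊔ {xs = y ∷ xs} (here refl)  = ℕP.m≤m⊔n y _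
∈⇒≤foldr-⊔ {xs = y ∷ xs} (there x∈xs) = ℕP.≤-trans (∈⇒≤foldr-⊔ x∈xs) (ℕP.m≤n⊔m y _)

edge⇒label+label≤strF : (G : SimpleGraph p) (f : Numbering p) {u v : Fin p} → adj G u v ≡ true →
              label f u ℕ.+ label f v ℕ.≤ strF G f
edge⇒label+label≤strF {p} G f {u} {v} uv =
  ∈⇒≤foldr-⊔ (∈-concatMap⁺ row (Any.map (λ { refl → sum∈row }) (∈-allFin u)))
  where
  edgeSum : Fin p → Fin p → ℕ
  edgeSum u′ v′ = if adj G u′ v′ then label f u′ ℕ.+ label f v′ else 0
  row : Fin p → List ℕ
  row u′ = map (edgeSum u′) (allFin p)
  sum∈row : label f u ℕ.+ label f v ∈ row u
  sum∈row = subst (_∈ row u) (cong (λ b → if b then _ else 0) uv)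
                  (∈-map⁺ (edgeSum u) (∈-allFin v))

heavyEdge : (G : SimpleGraph p) → NoIsolated G → (f : Numbering p) → 0 ℕ.< i → i ℕ.≤ p →
            ∃[ u ] ∃[ v ] (adj G u v ≡ true × p ∸ i ℕ.< label f u
                           × ∣ nbhdMinus G (topLabels f i) ∣ ℕ.≤ label f v)
heavyEdge {i = i} G noIsolated f 0<i i≤p with ∣ nbhdMinus G (topLabels f i) ∣ in ∣T∣≡
... | zero =
  let u , u∈S , _ = ∃-member-∣X∣≤label f (topLabels f i)
                      (subst (0 ℕ.<_) (sym (∣topLabels∣ f i≤p)) 0<i)
      v , uv      = noIsolated u
  in  u , v , uv , topLabels⇒p∸i<label f i u∈S , z≤n
... | suc _ =
  let v , v∈T , ∣T∣≤ = ∃-member-∣X∣≤label f (nbhdMinus G (topLabels f i))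
                         (subst (0 ℕ.<_) (sym ∣T∣≡) (s≤s z≤n))
      u , u∈S , uv   = nbhdMinus-witness G (topLabels f i) v∈T
  in  u , v , uv , topLabels⇒p∸i<label f i u∈S , subst (ℕ._≤ label f v) ∣T∣≡ ∣T∣≤

strF-lowerBound : (G : SimpleGraph p) → NoIsolated G → (f : Numbering p) → 0 ℕ.< i → i ℕ.≤ p →
                  suc p ℕ.+ xSeq G i ℕ.≤ strF G f ℕ.+ i
strF-lowerBound {p} {i} G noIsolated f 0<i i≤p =
  let u , v , uv , p∸i<fu , ∣T∣≤fv = heavyEdge G noIsolated f 0<i i≤p
      x≤fv = ℕP.≤-trans (xSeq≤∣nbhdMinus∣ G (topLabels f i) (∣topLabels∣ f i≤p)) ∣T∣≤fv
  in begin
    suc p ℕ.+ xSeq G i                  ≡⟨ cong (λ m → suc m ℕ.+ xSeq G i) (ℕP.m∸n+n≡m i≤p) ⟨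
    suc (p ∸ i) ℕ.+ i ℕ.+ xSeq G i      ≤⟨ ℕP.+-mono-≤ (ℕP.+-monoˡ-≤ i p∸i<fu) x≤fv ⟩
    label f u ℕ.+ i ℕ.+ label f v       ≡⟨ xy∙z≈xz∙y (label f u) i (label f v) ⟩
    label f u ℕ.+ label f v ℕ.+ i       ≤⟨ ℕP.+-monoˡ-≤ i (edge⇒label+label≤strF G f uv) ⟩
    strF G f ℕ.+ i                      ∎
  where open ℕP.≤-Reasoning

xiTerm≤strF-p : (G : SimpleGraph p) → NoIsolated G → (f : Numbering p) → 0 ℕ.< i → i ℕ.≤ p →
                xiTerm G i ≤ + strF G f ℤ.- + p
xiTerm≤strF-p {p} {i} G noIsolated f 0<i i≤p = begin
  + xSeq G i ℤ.- + i + + 1                 ≡⟨ rearrange (+ xSeq G i) (+ i) (+ p) ⟩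
  + (suc p ℕ.+ xSeq G i) ℤ.- + i ℤ.- + p   ≤⟨ ℤP.+-monoˡ-≤ (ℤ.- + p) (ℤP.+-monoˡ-≤ (ℤ.- + i)
                                                 (ℤ.+≤+ (strF-lowerBound G noIsolated f 0<i i≤p))) ⟩
  + (strF G f ℕ.+ i) ℤ.- + i ℤ.- + p       ≡⟨ cancel (+ strF G f) (+ i) (+ p) ⟩
  + strF G f ℤ.- + p                       ∎
  where
  open ℤP.≤-Reasoning
  -- Both identities are used at + m, + n, where + m + + n computes to + (m ℕ.+ n).
  rearrange : ∀ (x i p : ℤ.ℤ) → x ℤ.- i + ℤ.1ℤ ≡ ℤ.1ℤ + (p + x) ℤ.- i ℤ.- p
  rearrange = solve-∀
  cancel : ∀ (s i p : ℤ.ℤ) → s + i ℤ.- i ℤ.- p ≡ s ℤ.- p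
  cancel = solve-∀

foldr-⊔-lub : {A : Set} (g : A → ℤ.ℤ) {e b : ℤ.ℤ} (xs : List A) →
              e ≤ b → (∀ a → g a ≤ b) → foldr ℤ._⊔_ e (map g xs) ≤ b
foldr-⊔-lub g []       e≤b g≤b = e≤b
foldr-⊔-lub g (x ∷ xs) e≤b g≤b = ℤP.⊔-lub (g≤b x) (foldr-⊔-lub g xs e≤b g≤b)

mainTheorem4 : ∀ (p : ℕ) (G : SimpleGraph p) → NoIsolated G →
                 ∀ (s : ℕ) → IsStr G s → (+ p) + xi G ≤ (+ s)
-- For p = 0 there is no subset of size 1, so x_1 is the fold's default p = 0 and ξ = 0.
mainTheorem4 zero    G _          s _                   = ℤ.+≤+ z≤n
mainTheorem4 (suc p) G noIsolated s ((f , strF≡s) , _) = begin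
  + suc p + xi G                           ≤⟨ ℤP.+-monoʳ-≤ (+ suc p) xi≤ ⟩
  + suc p + (+ strF G f ℤ.- + suc p)       ≡⟨ cancel (+ suc p) (+ strF G f) ⟩
  + strF G f                               ≡⟨ cong +_ strF≡s ⟩
  + s                                      ∎
  where
  open ℤP.≤-Reasoning
  xi≤ : xi G ≤ + strF G f ℤ.- + suc p
  xi≤ = foldr-⊔-lub _ (allFin p) (xiTerm≤strF-p G noIsolated f (s≤s z≤n) (s≤s z≤n))
          (λ k → xiTerm≤strF-p G noIsolated f (s≤s z≤n) (s≤s (ℕP.<⇒≤ (FinP.toℕ<n k))))
  cancel : ∀ (p s : ℤ.ℤ) → p + (s ℤ.- p) ≡ s
  cancel = solve-∀
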